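{- Let $k>1$ and $m\geq 1$ be fixed integers. For integers $n\geq 1$ define $$B_n=S(\sigma_{n,k})=\sum_{l=0}^{n}(-1)^{\binom{l}{k}}\binom{n}{l},\qquad A_n=S\Big(\sum_{i=0}^{m}\binom{m}{i}\sigma_{n,k-i}\Big)=\sum_{l=0}^{n}(-1)^{\sum_{i=0}^{m}\binom{m}{i}\binom{l}{k-i}}\binom{n}{l}.$$ Then the sequence $(A_n)_{n\ge 1}$ satisfies the same homogeneous linear recurrence (with constant coefficients) as $(B_n)_{n\geq 1}$: every such recurrence satisfied by $(B_n)_{n\ge1}$ is also satisfied by $(A_n)_{n\ge1}$.
   Context: $\sigma_{n,k}$ denotes the elementary symmetric polynomial of degree $k$ in $X_1,\dots,X_n$ over $\mathbb{F}_2$; $\sigma_{n,0}$ is interpreted as $1$, terms $\sigma_{n,k-i}$ with $k-i<0$ are absent, and the coefficients $\binom{m}{i}$ in a Boolean polynomial are taken mod $2$. For a Boolean polynomial $G$ in $N$ variables, $S(G)=\sum_{x\in\mathbb{F}_2^N}(-1)^{G(x)}$. The exponential sums above are interpreted via the displayed binomial-sum formulas (which make sense for all $n\geq 1$, even when $n$ is smaller than the degree), with the convention $\binom{l}{a}=0$ for $a<0$ or $a>l$. -}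

module Defs where

open import Data.Nat using (ℕ; zero; suc; _+_; _*_; _∸_; _≤ᵇ_; _≤_)
open import Relation.Binary.PropositionalEquality using (_≡_)
open import Data.Nat.Combinatorics using (_C_)
open import Data.Bool using (if_then_else_)
open import Data.Integer using (ℤ; +_; -_) renaming (_+_ to _+ℤ_; _*_ to _*ℤ_)
open import Data.List using (List; []; _∷_)

sgn : ℕ → ℤ
sgn zero = + 1
sgn (suc zero) = - (+ 1)
sgn (suc (suc e)) = sgn e

sumTo : ℕ → (ℕ → ℤ) → ℤ
sumTo zero f = f 0
sumTo (suc n) f = sumTo n f +ℤ f (suc n)

sumToℕ : ℕ → (ℕ → ℕ) → ℕ
sumToℕ zero f = f 0
sumToℕ (suc n) f = sumToℕ n f + f (suc n)

B : ℕ → ℕ → ℤ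
B k n = sumTo n (λ l → sgn (l C k) *ℤ (+ (n C l)))

-- exponent Σ_{i=0}^{m} binom(m,i) binom(l,k-i), terms with k-i<0 absent
expA : ℕ → ℕ → ℕ → ℕ
expA k m l = sumToℕ m (λ i → if i ≤ᵇ k then (m C i) * (l C (k ∸ i)) else 0)

A : ℕ → ℕ → ℕ → ℤ
A k m n = sumTo n (λ l → sgn (expA k m l) *ℤ (+ (n C l)))

recAt : List ℤ → (ℕ → ℤ) → ℕ → ℤ
recAt [] s n = + 0
recAt (c ∷ cs) s n = c *ℤ s n +ℤ recAt cs s (suc n)

Satisfies : List ℤ → (ℕ → ℤ) → Set
Satisfies c s = ∀ n → 1 ≤ n → recAt c s n ≡ + 0

-- By Vandermonde's identity the exponent of A is (m + l) C k, so A is the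
-- binomial transform of l ↦ (-1)^((m + l) C k) while B is that of
-- l ↦ (-1)^(l C k).  By Pascal's rule, shifting the argument of a sequence
-- takes the forward difference of its binomial transform; hence A = Δ^m B,
-- and a constant-coefficient recurrence valid for B from n = 1 on is
-- inherited by every forward difference of B.
module Submission where

open import Defs
open import Data.Bool using (if_then_else_)
open import Data.Integer using (ℤ; +_; _+_; _*_; _-_)
open import Data.Integer.Properties using (+-assoc; +-identityʳ; *-identityʳ; *-zeroʳ; *-distribˡ-+; +-injective; pos-*; +-commutativeSemigroup)
open import Algebra.Properties.CommutativeSemigroup +-commutativeSemigroup using (interchange; x∙yz≈xz∙y)
open import Data.Integer.Tactic.RingSolver using (solve-∀)
open import Data.List using (List; []; _∷_)
open import Data.Nat using (ℕ; zero; suc; _<_; _≤_; s≤s; z≤n; _≤ᵇ_; _∸_) renaming (_+_ to _+ℕ_; _*_ to _*ℕ_)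
open import Data.Nat.Combinatorics using (_C_; nCk+nC[k+1]≡[n+1]C[k+1]; k>n⇒nCk≡0)
import Data.Nat.Properties as ℕ
open import Function using (_∘_)
open import Relation.Binary.PropositionalEquality using (_≡_; _≗_; refl; sym; trans; cong; cong₂; module ≡-Reasoning)

open ≡-Reasoning

sumTo-cong : ∀ n {f g : ℕ → ℤ} → f ≗ g → sumTo n f ≡ sumTo n g
sumTo-cong zero    f≗g = f≗g 0
sumTo-cong (suc n) f≗g = cong₂ _+_ (sumTo-cong n f≗g) (f≗g (suc n))

sumTo-unfoldˡ : ∀ n (f : ℕ → ℤ) → sumTo (suc n) f ≡ f 0 + sumTo n (f ∘ suc)
sumTo-unfoldˡ zero    f = refl
sumTo-unfoldˡ (suc n) f = begin
  sumTo (suc n) f + f (suc (suc n))                ≡⟨ cong (_+ f (suc (suc n))) (sumTo-unfoldˡ n f) ⟩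
  f 0 + sumTo n (f ∘ suc) + f (suc (suc n))        ≡⟨ +-assoc (f 0) (sumTo n (f ∘ suc)) (f (suc (suc n))) ⟩
  f 0 + (sumTo n (f ∘ suc) + f (suc (suc n)))      ∎

sumTo-+ : ∀ n (f g : ℕ → ℤ) → sumTo n (λ i → f i + g i) ≡ sumTo n f + sumTo n g
sumTo-+ zero    f g = refl
sumTo-+ (suc n) f g = begin
  sumTo n (λ i → f i + g i) + (f (suc n) + g (suc n))  ≡⟨ cong (_+ (f (suc n) + g (suc n))) (sumTo-+ n f g) ⟩
  sumTo n f + sumTo n g + (f (suc n) + g (suc n))      ≡⟨ interchange (sumTo n f) (sumTo n g) (f (suc n)) (g (suc n)) ⟩
  sumTo n f + f (suc n) + (sumTo n g + g (suc n))      ∎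

sumTo-zero : ∀ n → sumTo n (λ _ → + 0) ≡ + 0
sumTo-zero zero    = refl
sumTo-zero (suc n) = cong (_+ + 0) (sumTo-zero n)

sumTo-pos : ∀ n (f : ℕ → ℕ) → sumTo n (+_ ∘ f) ≡ + sumToℕ n f
sumTo-pos zero    f = refl
sumTo-pos (suc n) f = cong (_+ + f (suc n)) (sumTo-pos n f)

binomialTransform : (ℕ → ℤ) → ℕ → ℤ
binomialTransform f n = sumTo n (λ l → f l * + (n C l))

binomialTransform-cong : ∀ {f g} → f ≗ g → binomialTransform f ≗ binomialTransform g
binomialTransform-cong f≗g n = sumTo-cong n (λ l → cong (_* + (n C l)) (f≗g l))

binomialTransform-suc : ∀ f n →
  binomialTransform f (suc n) ≡ binomialTransform f n + binomialTransform (f ∘ suc) n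
binomialTransform-suc f n = begin
  binomialTransform f (suc n)
    ≡⟨ sumTo-unfoldˡ n _ ⟩
  h 0 + sumTo n (λ l → f (suc l) * + (suc n C suc l))
    ≡⟨ cong (λ x → h 0 + x) (trans (sumTo-cong n pascal) (sumTo-+ n _ _)) ⟩
  h 0 + (binomialTransform (f ∘ suc) n + sumTo n (h ∘ suc))
    ≡⟨ x∙yz≈xz∙y (h 0) (binomialTransform (f ∘ suc) n) (sumTo n (h ∘ suc)) ⟩
  h 0 + sumTo n (h ∘ suc) + binomialTransform (f ∘ suc) n
    ≡⟨ cong (_+ binomialTransform (f ∘ suc) n) (sym (sumTo-unfoldˡ n h)) ⟩
  sumTo n h + h (suc n) + binomialTransform (f ∘ suc) n
    ≡⟨ cong (λ x → sumTo n h + x + binomialTransform (f ∘ suc) n) h[1+n]≡0 ⟩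
  sumTo n h + + 0 + binomialTransform (f ∘ suc) n
    ≡⟨ cong (_+ binomialTransform (f ∘ suc) n) (+-identityʳ (sumTo n h)) ⟩
  binomialTransform f n + binomialTransform (f ∘ suc) n
    ∎
  where
  h : ℕ → ℤ
  h l = f l * + (n C l)

  pascal : ∀ l → f (suc l) * + (suc n C suc l) ≡ f (suc l) * + (n C l) + h (suc l)
  pascal l = trans (cong (λ x → f (suc l) * + x) (sym (nCk+nC[k+1]≡[n+1]C[k+1] n l)))
                   (*-distribˡ-+ (f (suc l)) (+ (n C l)) (+ (n C suc l)))

  h[1+n]≡0 : h (suc n) ≡ + 0
  h[1+n]≡0 = trans (cong (λ x → f (suc n) * + x) (k>n⇒nCk≡0 (ℕ.n<1+n n))) (*-zeroʳ (f (suc n)))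

-- l C (k - i), read as 0 when i > k (rather than truncating k ∸ i to 0)
chooseDiff : ℕ → ℕ → ℕ → ℕ
chooseDiff l k       zero    = l C k
chooseDiff l zero    (suc i) = 0
chooseDiff l (suc k) (suc i) = chooseDiff l k i

vandermonde : ∀ l k m → binomialTransform (λ i → + chooseDiff l k i) m ≡ + ((m +ℕ l) C k)
vandermonde l k       zero    = *-identityʳ (+ (l C k))
vandermonde l zero    (suc m) = begin
  binomialTransform (λ i → + chooseDiff l 0 i) (suc m)
    ≡⟨ binomialTransform-suc (λ i → + chooseDiff l 0 i) m ⟩
  binomialTransform (λ i → + chooseDiff l 0 i) m + binomialTransform (λ _ → + 0) m
    ≡⟨ cong₂ _+_ (vandermonde l 0 m) (sumTo-zero m) ⟩
  + 1 ∎
vandermonde l (suc k) (suc m) = begin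
  binomialTransform (λ i → + chooseDiff l (suc k) i) (suc m)
    ≡⟨ binomialTransform-suc (λ i → + chooseDiff l (suc k) i) m ⟩
  binomialTransform (λ i → + chooseDiff l (suc k) i) m + binomialTransform (λ i → + chooseDiff l k i) m
    ≡⟨ cong₂ _+_ (vandermonde l (suc k) m) (vandermonde l k m) ⟩
  + ((m +ℕ l) C suc k +ℕ (m +ℕ l) C k)
    ≡⟨ cong +_ (trans (ℕ.+-comm ((m +ℕ l) C suc k) ((m +ℕ l) C k)) (nCk+nC[k+1]≡[n+1]C[k+1] (m +ℕ l) k)) ⟩
  + ((suc m +ℕ l) C suc k) ∎

≤ᵇ-suc : ∀ i k → (suc i ≤ᵇ suc k) ≡ (i ≤ᵇ k)
≤ᵇ-suc zero    k = refl
≤ᵇ-suc (suc i) k = refl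

vandermondeTerm≡chooseDiff : ∀ l k i a →
  (if i ≤ᵇ k then a *ℕ (l C (k ∸ i)) else 0) ≡ chooseDiff l k i *ℕ a
vandermondeTerm≡chooseDiff l k       zero    a = ℕ.*-comm a (l C k)
vandermondeTerm≡chooseDiff l zero    (suc i) a = refl
vandermondeTerm≡chooseDiff l (suc k) (suc i) a =
  trans (cong (λ b → if b then a *ℕ (l C (k ∸ i)) else 0) (≤ᵇ-suc i k))
        (vandermondeTerm≡chooseDiff l k i a)

expA≡[m+l]Ck : ∀ k m l → expA k m l ≡ (m +ℕ l) C k
expA≡[m+l]Ck k m l = +-injective (begin
  + expA k m l
    ≡⟨ sym (sumTo-pos m _) ⟩
  sumTo m (λ i → + (if i ≤ᵇ k then (m C i) *ℕ (l C (k ∸ i)) else 0))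
    ≡⟨ sumTo-cong m (λ i → trans (cong +_ (vandermondeTerm≡chooseDiff l k i (m C i)))
                                 (pos-* (chooseDiff l k i) (m C i))) ⟩
  binomialTransform (λ i → + chooseDiff l k i) m
    ≡⟨ vandermonde l k m ⟩
  + ((m +ℕ l) C k) ∎)

Δ : (ℕ → ℤ) → ℕ → ℤ
Δ s n = s (suc n) - s n

binomialTransform-shift : ∀ f → binomialTransform (f ∘ suc) ≗ Δ (binomialTransform f)
binomialTransform-shift f n = begin
  binomialTransform (f ∘ suc) n
    ≡⟨ b≡a+b-a (binomialTransform f n) (binomialTransform (f ∘ suc) n) ⟩
  binomialTransform f n + binomialTransform (f ∘ suc) n - binomialTransform f n
    ≡⟨ cong (_- binomialTransform f n) (sym (binomialTransform-suc f n)) ⟩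
  Δ (binomialTransform f) n ∎
  where
  b≡a+b-a : ∀ a b → b ≡ a + b - a
  b≡a+b-a = solve-∀

recAt-cong : ∀ c {s t} → s ≗ t → recAt c s ≗ recAt c t
recAt-cong []      s≗t n = refl
recAt-cong (x ∷ c) s≗t n = cong₂ (λ a b → x * a + b) (s≗t n) (recAt-cong c s≗t (suc n))

recAt-Δ : ∀ c s → recAt c (Δ s) ≗ Δ (recAt c s)
recAt-Δ []      s n = refl
recAt-Δ (x ∷ c) s n = begin
  x * Δ s n + recAt c (Δ s) (suc n)
    ≡⟨ cong (λ y → x * Δ s n + y) (recAt-Δ c s (suc n)) ⟩
  x * (s (suc n) - s n) + (recAt c s (suc (suc n)) - recAt c s (suc n))
    ≡⟨ linearity x (s (suc n)) (s n) (recAt c s (suc (suc n))) (recAt c s (suc n)) ⟩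
  Δ (recAt (x ∷ c) s) n ∎
  where
  linearity : ∀ x a b p q → x * (a - b) + (p - q) ≡ (x * a + p) - (x * b + q)
  linearity = solve-∀

Satisfies-cong : ∀ c {s t} → s ≗ t → Satisfies c s → Satisfies c t
Satisfies-cong c s≗t sat n 1≤n = trans (sym (recAt-cong c s≗t n)) (sat n 1≤n)

Satisfies-Δ : ∀ c s → Satisfies c s → Satisfies c (Δ s)
Satisfies-Δ c s sat n 1≤n = trans (recAt-Δ c s n) (cong₂ _-_ (sat (suc n) (s≤s z≤n)) (sat n 1≤n))

Satisfies-binomialTransform-shift : ∀ c j f → Satisfies c (binomialTransform f) →
  Satisfies c (binomialTransform (λ l → f (j +ℕ l)))
Satisfies-binomialTransform-shift c zero    f sat = sat
Satisfies-binomialTransform-shift c (suc j) f sat =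
  Satisfies-binomialTransform-shift c j (f ∘ suc)
    (Satisfies-cong c (sym ∘ binomialTransform-shift f) (Satisfies-Δ c _ sat))

lemma3p1 : (k m : ℕ) → 1 < k → 1 ≤ m →
    (c : List ℤ) → Satisfies c (B k) → Satisfies c (A k m)
lemma3p1 k m _ _ c sat =
  Satisfies-cong c (binomialTransform-cong (λ l → cong sgn (sym (expA≡[m+l]Ck k m l))))
    (Satisfies-binomialTransform-shift c m (λ l → sgn (l C k)) sat)
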